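{- LFI3 is a sublogic of LFI1: for every set of formulas $\Gamma\cup\{\alpha\}$, if $\Gamma\vdash_{LFI3}\alpha$ then $\Gamma\vdash_{LFI1}\alpha$.
   Context: Formulas are built from propositional variables using unary $\neg,\circ$ and binary $\land,\lor,\to$. Let $\land,\lor,\to,\sim$ denote Boolean operations on $\{0,1\}$. LFI3 is the logic of the 5-valued matrix with domain $\{T=(1,0,0),\ t=(1,0,1),\ b=(1,1,1),\ f=(0,1,1),\ F=(0,1,0)\}$, designated set $\{T,t,b\}$, and operations $a\dot\land b=(a_1\land b_1,\ a_2\lor b_2,\ (\sim a_2\land b_3)\lor(a_3\land\sim b_2)\lor(a_3\land b_3))$; $a\dot\lor b=(a_1\lor b_1,\ a_2\land b_2,\ (\sim a_1\land b_3)\lor(a_3\land\sim b_1)\lor(a_3\land b_3))$; $a\dot\to b=(a_1\to b_1,\ b_2\land(\sim a_2\lor a_3),\ (\sim a_2\land b_3)\lor(\sim a_2\land a_3\land\sim b_1)\lor(a_3\land b_3)\lor(\sim a_1\land a_3\land\sim b_1))$; $\dot\neg(a_1,a_2,a_3)=(a_2,a_1,a_3)$; $\dot\circ(a_1,a_2,a_3)=(\sim(a_1\land a_2),\ a_3,\ a_3\land\sim(a_1\land a_2))$. LFI1 is the logic of the 3-valued matrix with domain $\{1,1/2,0\}$, designated set $\{1,1/2\}$, $\neg1=0$, $\neg\tfrac12=\tfrac12$, $\neg0=1$, $\circ1=\circ0=1$, $\circ\tfrac12=0$, $\land=\min$, $\lor=\max$, $x\to y=1$ if $x=0$ and $x\to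 y=y$ otherwise. For a matrix, valuations are homomorphisms from formulas into its algebra, and $\Gamma\vdash\alpha$ iff every valuation designating all members of $\Gamma$ designates $\alpha$. -}

module Defs where

open import Data.Nat using (ℕ)
open import Data.Bool using (Bool; true; false; _∧_; _∨_; not)
open import Data.Product using (_×_; _,_)

data Formula : Set where
  var  : ℕ → Formula
  ¬'_  : Formula → Formula
  ∘'_  : Formula → Formula
  _∧'_ : Formula → Formula → Formula
  _∨'_ : Formula → Formula → Formula
  _⇒'_ : Formula → Formula → Formula

_⇛_ : Bool → Bool → Bool
a ⇛ b = not a ∨ b

Triple : Set
Triple = Bool × Bool × Bool

data V5 : Set where
  T t b f F : V5

enc : V5 → Triple
enc T = true  , false , false
enc t = true  , false , true
enc b = true  , true  , true
enc f = false , true  , true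
enc F = false , true  , false

-- decoding; the domain is closed under the operations, so the default
-- branch is never reached on images of enc-combinations (checked below)
dec : Triple → V5
dec (true  , false , false) = T
dec (true  , false , true)  = t
dec (true  , true  , true)  = b
dec (false , true  , true)  = f
dec (false , true  , false) = F
dec _                       = T

and3 : Triple → Triple → Triple
and3 (a1 , a2 , a3) (b1 , b2 , b3) =
  (a1 ∧ b1) , (a2 ∨ b2) ,
  (((not a2 ∧ b3) ∨ (a3 ∧ not b2)) ∨ (a3 ∧ b3))

or3 : Triple → Triple → Triple
or3 (a1 , a2 , a3) (b1 , b2 , b3) =
  (a1 ∨ b1) , (a2 ∧ b2) ,
  (((not a1 ∧ b3) ∨ (a3 ∧ not b1)) ∨ (a3 ∧ b3))

imp3 : Triple → Triple → Triple
imp3 (a1 , a2 , a3) (b1 , b2 , b3) =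
  (a1 ⇛ b1) , (b2 ∧ (not a2 ∨ a3)) ,
  ((((not a2 ∧ b3) ∨ ((not a2 ∧ a3) ∧ not b1)) ∨ (a3 ∧ b3))
     ∨ ((not a1 ∧ a3) ∧ not b1))

neg3 : Triple → Triple
neg3 (a1 , a2 , a3) = a2 , a1 , a3

circ3 : Triple → Triple
circ3 (a1 , a2 , a3) = not (a1 ∧ a2) , a3 , (a3 ∧ not (a1 ∧ a2))

_∧₅_ _∨₅_ _⇒₅_ : V5 → V5 → V5
x ∧₅ y = dec (and3 (enc x) (enc y))
x ∨₅ y = dec (or3 (enc x) (enc y))
x ⇒₅ y = dec (imp3 (enc x) (enc y))

¬₅_ ∘₅_ : V5 → V5
¬₅ x = dec (neg3 (enc x))
∘₅ x = dec (circ3 (enc x))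

data Des₅ : V5 → Set where
  desT : Des₅ T
  dest : Des₅ t
  desb : Des₅ b

-- valuations = homomorphisms from formulas: determined by variable assignment
⟦_⟧₅ : Formula → (ℕ → V5) → V5
⟦ var n ⟧₅ v = v n
⟦ ¬' φ ⟧₅ v = ¬₅ (⟦ φ ⟧₅ v)
⟦ ∘' φ ⟧₅ v = ∘₅ (⟦ φ ⟧₅ v)
⟦ φ ∧' ψ ⟧₅ v = ⟦ φ ⟧₅ v ∧₅ ⟦ ψ ⟧₅ v
⟦ φ ∨' ψ ⟧₅ v = ⟦ φ ⟧₅ v ∨₅ ⟦ ψ ⟧₅ v
⟦ φ ⇒' ψ ⟧₅ v = ⟦ φ ⟧₅ v ⇒₅ ⟦ ψ ⟧₅ v

_⊢LFI3_ : (Formula → Set) → Formula → Set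
Γ ⊢LFI3 α = (v : ℕ → V5) → (∀ γ → Γ γ → Des₅ (⟦ γ ⟧₅ v)) → Des₅ (⟦ α ⟧₅ v)

data V3 : Set where
  one half zero : V3

¬₃_ ∘₃_ : V3 → V3
¬₃ one  = zero
¬₃ half = half
¬₃ zero = one
∘₃ one  = one
∘₃ half = zero
∘₃ zero = one

_∧₃_ : V3 → V3 → V3
zero ∧₃ y    = zero
one  ∧₃ y    = y
half ∧₃ zero = zero
half ∧₃ one  = half
half ∧₃ half = half

_∨₃_ : V3 → V3 → V3
zero ∨₃ y    = y
one  ∨₃ y    = one
half ∨₃ zero = half
half ∨₃ one  = one
half ∨₃ half = half

_⇒₃_ : V3 → V3 → V3
zero ⇒₃ y = one
one  ⇒₃ y = y
half ⇒₃ y = y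

data Des₃ : V3 → Set where
  desOne  : Des₃ one
  desHalf : Des₃ half

⟦_⟧₃ : Formula → (ℕ → V3) → V3
⟦ var n ⟧₃ v = v n
⟦ ¬' φ ⟧₃ v = ¬₃ (⟦ φ ⟧₃ v)
⟦ ∘' φ ⟧₃ v = ∘₃ (⟦ φ ⟧₃ v)
⟦ φ ∧' ψ ⟧₃ v = ⟦ φ ⟧₃ v ∧₃ ⟦ ψ ⟧₃ v
⟦ φ ∨' ψ ⟧₃ v = ⟦ φ ⟧₃ v ∨₃ ⟦ ψ ⟧₃ v
⟦ φ ⇒' ψ ⟧₃ v = ⟦ φ ⟧₃ v ⇒₃ ⟦ ψ ⟧₃ v

_⊢LFI1_ : (Formula → Set) → Formula → Set
Γ ⊢LFI1 α = (v : ℕ → V3) → (∀ γ → Γ γ → Des₃ (⟦ γ ⟧₃ v)) → Des₃ (⟦ α ⟧₃ v)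

-- The LFI1 matrix is isomorphic to the submatrix of the LFI3 matrix on {T, b, F}
-- (1 ↦ T, ½ ↦ b, 0 ↦ F), and this embedding preserves and reflects designation.
-- Composing an LFI1 valuation with it yields an LFI3 valuation designating exactly
-- the same formulas, so every LFI1 counter-model to Γ ⊢ α is also an LFI3 one.
module Submission where

open import Defs
open import Data.Nat using (ℕ)
open import Function using (_∘_)
open import Relation.Binary.PropositionalEquality using (_≡_; refl; sym; trans; cong; cong₂; subst)

embed : V3 → V5
embed one  = T
embed half = b
embed zero = F

embed-¬ : ∀ x → ¬₅ embed x ≡ embed (¬₃ x)
embed-¬ one  = refl
embed-¬ half = refl
embed-¬ zero = refl

embed-∘ : ∀ x → ∘₅ embed x ≡ embed (∘₃ x)
embed-∘ one  = refl
embed-∘ half = refl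
embed-∘ zero = refl

embed-∧ : ∀ x y → embed x ∧₅ embed y ≡ embed (x ∧₃ y)
embed-∧ one  one  = refl
embed-∧ one  half = refl
embed-∧ one  zero = refl
embed-∧ half one  = refl
embed-∧ half half = refl
embed-∧ half zero = refl
embed-∧ zero one  = refl
embed-∧ zero half = refl
embed-∧ zero zero = refl

embed-∨ : ∀ x y → embed x ∨₅ embed y ≡ embed (x ∨₃ y)
embed-∨ one  one  = refl
embed-∨ one  half = refl
embed-∨ one  zero = refl
embed-∨ half one  = refl
embed-∨ half half = refl
embed-∨ half zero = refl
embed-∨ zero one  = refl
embed-∨ zero half = refl
embed-∨ zero zero = refl

embed-⇒ : ∀ x y → embed x ⇒₅ embed y ≡ embed (x ⇒₃ y)
embed-⇒ one  one  = refl
embed-⇒ one  half = refl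
embed-⇒ one  zero = refl
embed-⇒ half one  = refl
embed-⇒ half half = refl
embed-⇒ half zero = refl
embed-⇒ zero one  = refl
embed-⇒ zero half = refl
embed-⇒ zero zero = refl

⟦⟧₅-embed : ∀ φ (v : ℕ → V3) → ⟦ φ ⟧₅ (embed ∘ v) ≡ embed (⟦ φ ⟧₃ v)
⟦⟧₅-embed (var n)  v = refl
⟦⟧₅-embed (¬' φ)   v = trans (cong ¬₅_ (⟦⟧₅-embed φ v)) (embed-¬ _)
⟦⟧₅-embed (∘' φ)   v = trans (cong ∘₅_ (⟦⟧₅-embed φ v)) (embed-∘ _)
⟦⟧₅-embed (φ ∧' ψ) v =
  trans (cong₂ _∧₅_ (⟦⟧₅-embed φ v) (⟦⟧₅-embed ψ v))
        (embed-∧ (⟦ φ ⟧₃ v) (⟦ ψ ⟧₃ v))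
⟦⟧₅-embed (φ ∨' ψ) v =
  trans (cong₂ _∨₅_ (⟦⟧₅-embed φ v) (⟦⟧₅-embed ψ v))
        (embed-∨ (⟦ φ ⟧₃ v) (⟦ ψ ⟧₃ v))
⟦⟧₅-embed (φ ⇒' ψ) v =
  trans (cong₂ _⇒₅_ (⟦⟧₅-embed φ v) (⟦⟧₅-embed ψ v))
        (embed-⇒ (⟦ φ ⟧₃ v) (⟦ ψ ⟧₃ v))

embed-preserves-Des : ∀ {x} → Des₃ x → Des₅ (embed x)
embed-preserves-Des desOne  = desT
embed-preserves-Des desHalf = desb

embed-reflects-Des : ∀ {x} → Des₅ (embed x) → Des₃ x
embed-reflects-Des {one}  _ = desOne
embed-reflects-Des {half} _ = desHalf
embed-reflects-Des {zero} ()

theorem13 : (Γ : Formula → Set) (α : Formula) → Γ ⊢LFI3 α → Γ ⊢LFI1 α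
theorem13 Γ α Γ⊢α v v⊨Γ =
  embed-reflects-Des (subst Des₅ (⟦⟧₅-embed α v) (Γ⊢α (embed ∘ v) embed∘v⊨Γ))
  where
    embed∘v⊨Γ : ∀ γ → Γ γ → Des₅ (⟦ γ ⟧₅ (embed ∘ v))
    embed∘v⊨Γ γ γ∈Γ = subst Des₅ (sym (⟦⟧₅-embed γ v)) (embed-preserves-Des (v⊨Γ γ γ∈Γ))
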